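{- The discontinuity problem $\mathrm{DIS}$ is computably discontinuous.
   Context: Pairing: $\langle p,q\rangle(2n)=p(n)$, $\langle p,q\rangle(2n+1)=q(n)$. $\Phi$ is the standard total representation of continuous partial functions on Baire space (Weihrauch): $\Phi_q(p)=\sup_{w\sqsubseteq p}h(w)$ for the monotone word function $h$ whose graph is listed by $q$ (inconsistent $q$ name the nowhere defined function); every continuous partial function on Baire space has an extension $\Phi_q$, and the smn theorem holds. $\mathrm U\langle q,p\rangle:=\Phi_q(p)$ is the computable universal function. $\mathrm{DIS}:\mathbb{N}^\mathbb{N}\rightrightarrows\mathbb{N}^\mathbb{N}$, $\mathrm{DIS}(p):=\{q\in\mathbb{N}^\mathbb{N}:\mathrm U(p)\ne q\}$ (every $q$ if $p\notin\mathrm{dom}\,\mathrm U$). A problem $f:\subseteq\mathbb{N}^\mathbb{N}\rightrightarrows\mathbb{N}^\mathbb{N}$ is computably discontinuous if there is a computable total $D:\mathbb{N}^\mathbb{N}\to\mathbb{N}^\mathbb{N}$ with $D(q)\in\mathrm{dom}(f)$ and $\Phi_qD(q)\notin f(D(q))$ for all $q$ (counted as satisfied when $\Phi_qD(q)$ is undefined). -}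

module Defs where

open import Data.Nat using (ℕ; zero; suc; _<_)
open import Data.Fin using (Fin)
open import Data.Vec using (Vec; []; _∷_; lookup)
open import Data.List using (List; []; _∷_)
open import Data.Maybe using (Maybe; just; nothing)
open import Data.Product using (Σ; ∃; _×_; _,_; proj₁; proj₂)
open import Data.Unit using (⊤)
open import Relation.Binary.PropositionalEquality using (_≡_)
open import Relation.Nullary using (¬_)

Baire : Set
Baire = ℕ → ℕ

-- Pairing ⟨p,q⟩(2n) = p(n), ⟨p,q⟩(2n+1) = q(n), and its projections.
pair : Baire → Baire → Baire
pair p q zero = p zero
pair p q (suc zero) = q zero
pair p q (suc (suc n)) = pair (λ k → p (suc k)) (λ k → q (suc k)) n

π₁ : Baire → Baire
π₁ p n = p (n Data.Nat.* 2)

π₂ : Baire → Baire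
π₂ p n = p (suc (n Data.Nat.* 2))

-- Coding of (finite) words and pairs of words by natural numbers.
-- Cantor unpairing, defined by enumerating ℕ × ℕ along diagonals.
next : ℕ × ℕ → ℕ × ℕ
next (zero , b) = (suc b , zero)
next (suc a , b) = (a , suc b)

unpair : ℕ → ℕ × ℕ
unpair zero = (zero , zero)
unpair (suc n) = next (unpair n)

decodeLen : ℕ → ℕ → List ℕ
decodeLen zero c = []
decodeLen (suc l) c = proj₁ (unpair c) ∷ decodeLen l (proj₂ (unpair c))

decodeWord : ℕ → List ℕ
decodeWord n = decodeLen (proj₁ (unpair n)) (proj₂ (unpair n))

decodeEntry : ℕ → List ℕ × List ℕ
decodeEntry n = decodeWord (proj₁ (unpair n)) , decodeWord (proj₂ (unpair n))

data _⊑_ : List ℕ → List ℕ → Set where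
  []⊑ : ∀ {u} → [] ⊑ u
  ∷⊑  : ∀ {x w u} → w ⊑ u → (x ∷ w) ⊑ (x ∷ u)

_⊑ᵇ_ : List ℕ → Baire → Set
[] ⊑ᵇ p = ⊤
(x ∷ w) ⊑ᵇ p = (x ≡ p zero) × (w ⊑ᵇ (λ k → p (suc k)))

_!!_ : List ℕ → ℕ → Maybe ℕ
[] !! n = nothing
(x ∷ w) !! zero = just x
(x ∷ w) !! suc n = w !! n

-- The representation Φ of continuous partial functions on Baire space.
-- q lists the graph of a word function h: q(k) = 0 lists nothing,
-- q(k) = c+1 lists the pair decodeEntry c = (w , h(w)).
Entry : Baire → List ℕ → List ℕ → Set
Entry q w u = ∃ λ k → ∃ λ c → (q k ≡ suc c) × (decodeEntry c ≡ (w , u))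

-- q is consistent: the listed graph is that of a monotone word function
-- (monotonicity w ⊑ w' ⇒ h(w) ⊑ h(w') includes functionality).
Consistent : Baire → Set
Consistent q = ∀ {w u w′ u′} → Entry q w u → Entry q w′ u′ → w ⊑ w′ → u ⊑ u′

-- Φ_q(p)(n) = v   (Φ_q(p) = sup_{w ⊑ p} h(w); inconsistent q name the
-- nowhere defined function)
ΦAt : Baire → Baire → ℕ → ℕ → Set
ΦAt q p n v = Consistent q ×
  ∃ λ w → ∃ λ u → Entry q w u × (w ⊑ᵇ p) × (u !! n ≡ just v)

Φ≡ : Baire → Baire → Baire → Set
Φ≡ q p r = ∀ n → ΦAt q p n (r n)

U≡ : Baire → Baire → Set
U≡ x r = Φ≡ (π₁ x) (π₂ x) r

-- DIS(p) = { r : U(p) ≠ r }   (every r if p ∉ dom U)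
DIS : Baire → Baire → Set
DIS p r = ¬ U≡ p r

data Rec : ℕ → Set where
  zer  : ∀ {n} → Rec n
  succ : Rec 1
  proj : ∀ {n} → Fin n → Rec n
  comp : ∀ {m n} → Rec m → Vec (Rec n) m → Rec n
  prec : ∀ {n} → Rec n → Rec (suc (suc n)) → Rec (suc n)
  mu   : ∀ {n} → Rec (suc n) → Rec n

mutual
  data _[_]⇓_ : ∀ {n} → Rec n → Vec ℕ n → ℕ → Set where
    zer⇓  : ∀ {n} {xs : Vec ℕ n} → zer [ xs ]⇓ zero
    succ⇓ : ∀ {x} → succ [ x ∷ [] ]⇓ suc x
    proj⇓ : ∀ {n} {i : Fin n} {xs} → proj i [ xs ]⇓ lookup xs i
    comp⇓ : ∀ {m n} {f : Rec m} {gs : Vec (Rec n) m} {xs ys v} →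
            gs [ xs ]⇓* ys → f [ ys ]⇓ v → comp f gs [ xs ]⇓ v
    prec0⇓ : ∀ {n} {f : Rec n} {g} {xs v} →
             f [ xs ]⇓ v → prec f g [ zero ∷ xs ]⇓ v
    precS⇓ : ∀ {n} {f : Rec n} {g} {y xs u v} →
             prec f g [ y ∷ xs ]⇓ u → g [ y ∷ u ∷ xs ]⇓ v →
             prec f g [ suc y ∷ xs ]⇓ v
    mu⇓   : ∀ {n} {f : Rec (suc n)} {xs y} →
            f [ y ∷ xs ]⇓ zero →
            (∀ z → z < y → ∃ λ k → f [ z ∷ xs ]⇓ suc k) →
            mu f [ xs ]⇓ y

  data _[_]⇓*_ : ∀ {m n} → Vec (Rec n) m → Vec ℕ n → Vec ℕ m → Set where
    []⇓  : ∀ {n} {xs : Vec ℕ n} → [] [ xs ]⇓* []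
    ∷⇓   : ∀ {m n} {g : Rec n} {gs : Vec (Rec n) m} {xs y ys} →
           g [ xs ]⇓ y → gs [ xs ]⇓* ys → (g ∷ gs) [ xs ]⇓* (y ∷ ys)

ComputableSeq : Baire → Set
ComputableSeq c = ∃ λ (e : Rec 1) → ∀ n → e [ n ∷ [] ]⇓ c n

ComputableTotal : (Baire → Baire) → Set
ComputableTotal D = ∃ λ c → ComputableSeq c × (∀ p → Φ≡ c p (D p))

-- f is computably discontinuous (for f with dom f = Baire space, as DIS):
-- there is a computable total D with Φ_q D(q) ∉ f(D(q)) whenever defined.
ComputablyDiscontinuousTotal : (Baire → Baire → Set) → Set
ComputablyDiscontinuousTotal f =
  Σ (Baire → Baire) λ D → ComputableTotal D ×
    (∀ q r → Φ≡ q (D q) r → ¬ f (D q) r)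

{-# OPTIONS --safe #-}
module Submission where

-- Let D q be the sequence with D q (2n) = q n and D q (2n+1) = D q n, so that ⟨q , D q⟩ = D q.
-- Then U (D q) = Φ_q (D q), hence any value r of Φ_q (D q) is excluded from DIS (D q).
-- D is computable: D q m = q (source m) for a primitive recursive index map source, and a
-- Φ-name of D lists exactly the pairs of words (w , u) with |u| = |w| and u_i = w_(source i);
-- whether a code denotes such a pair is decided by a primitive recursive function.

open import Defs
open import Data.Nat using (ℕ; zero; suc; _+_; _*_; _∸_; _≤_; _<_; z≤n; s≤s; pred; ⌊_/2⌋)
open import Data.Nat.Properties
open import Data.Nat.GeneralisedArithmetic using (fold; fold-+)
open import Data.Fin using () renaming (zero to fzero; suc to fsuc)
open import Data.Vec using (Vec; []; _∷_)
open import Data.List using (List; []; _∷_; length)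
open import Data.Maybe using (just)
open import Data.Maybe.Properties using (just-injective)
open import Data.Product using (∃; _×_; _,_; proj₁; proj₂; uncurry; map)
open import Data.Sum using (_⊎_; inj₁; inj₂)
open import Data.Unit using (tt)
open import Function using (_∘_)
open import Relation.Binary.PropositionalEquality
open import Relation.Nullary using (contradiction)

module _ (f : ℕ → ℕ) where

  fold-suc : ∀ x n → fold x f (suc n) ≡ fold (f x) f n
  fold-suc x zero    = refl
  fold-suc x (suc n) = cong f (fold-suc x n)

  fold-fixedPoint : ∀ {x} → f x ≡ x → ∀ n → fold x f n ≡ x
  fold-fixedPoint fx≡x zero    = refl
  fold-fixedPoint fx≡x (suc n) = trans (cong f (fold-fixedPoint fx≡x n)) fx≡x

  module _ (fixed-or-decreasing : ∀ x → f x ≡ x ⊎ f x < x) where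

    fold-≤ : ∀ x n → fold x f n ≤ x
    fold-≤ x zero    = ≤-refl
    fold-≤ x (suc n) = ≤-trans (f≤ (fold x f n)) (fold-≤ x n)
      where
      f≤ : ∀ y → f y ≤ y
      f≤ y with fixed-or-decreasing y
      ... | inj₁ fy≡y = ≤-reflexive fy≡y
      ... | inj₂ fy<y = <⇒≤ fy<y

    fold-reachesFixedPoint : ∀ {x} n → x ≤ n → f (fold x f n) ≡ fold x f n
    fold-reachesFixedPoint zero z≤n with fixed-or-decreasing 0
    ... | inj₁ f0≡0 = f0≡0
    fold-reachesFixedPoint {x} (suc n) x≤1+n with fixed-or-decreasing x
    ... | inj₁ fx≡x = subst (λ y → f y ≡ y) (sym (fold-fixedPoint fx≡x (suc n))) fx≡x
    ... | inj₂ fx<x = subst (λ y → f y ≡ y) (sym (fold-suc x n))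
                            (fold-reachesFixedPoint n (≤-pred (≤-trans fx<x x≤1+n)))

    fold-saturates : ∀ {x n} → x ≤ n → fold x f n ≡ fold x f x
    fold-saturates {x} {n} x≤n = begin
      fold x f n                     ≡⟨ cong (fold x f) (sym (m∸n+n≡m x≤n)) ⟩
      fold x f ((n ∸ x) + x)         ≡⟨ fold-+ x f (n ∸ x) ⟩
      fold (fold x f x) f (n ∸ x)    ≡⟨ fold-fixedPoint (fold-reachesFixedPoint x ≤-refl) (n ∸ x) ⟩
      fold x f x                     ∎
      where open ≡-Reasoning

parity : ℕ → ℕ
parity zero    = zero
parity (suc n) = 1 ∸ parity n

half : ℕ → ℕ
half zero    = zero
half (suc n) = half n + parity n

parity≤1 : ∀ n → parity n ≤ 1
parity≤1 zero    = z≤n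
parity≤1 (suc n) = m∸n≤m 1 (parity n)

parity-even : ∀ n → parity (n * 2) ≡ 0
parity-odd  : ∀ n → parity (suc (n * 2)) ≡ 1
parity-even zero    = refl
parity-even (suc n) = cong (1 ∸_) (parity-odd n)
parity-odd n        = cong (1 ∸_) (parity-even n)

half-even : ∀ n → half (n * 2) ≡ n
half-odd  : ∀ n → half (suc (n * 2)) ≡ n
half-even zero    = refl
half-even (suc n) = trans (cong₂ _+_ (half-odd n) (parity-odd n)) (+-comm n 1)
half-odd n        = trans (cong₂ _+_ (half-even n) (parity-even n)) (+-identityʳ n)

half≡⌊/2⌋ : ∀ n → half n ≡ ⌊ n /2⌋
half≡⌊/2⌋ zero          = refl
half≡⌊/2⌋ (suc zero)    = refl
half≡⌊/2⌋ (suc (suc n)) = begin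
  half n + parity n + (1 ∸ parity n)    ≡⟨ +-assoc (half n) (parity n) (1 ∸ parity n) ⟩
  half n + (parity n + (1 ∸ parity n))  ≡⟨ cong (half n +_) (m+[n∸m]≡n (parity≤1 n)) ⟩
  half n + 1                            ≡⟨ +-comm (half n) 1 ⟩
  suc (half n)                          ≡⟨ cong suc (half≡⌊/2⌋ n) ⟩
  suc ⌊ n /2⌋                           ∎
  where open ≡-Reasoning

even-or-odd : ∀ x → ∃ λ n → x ≡ n * 2 ⊎ x ≡ suc (n * 2)
even-or-odd zero = 0 , inj₁ refl
even-or-odd (suc x) with even-or-odd x
... | n , inj₁ x≡2n   = n , inj₂ (cong suc x≡2n)
... | n , inj₂ x≡2n+1 = suc n , inj₁ (cong suc x≡2n+1)

-- Written with 0/1 factors instead of a case split so that it is visibly primitive recursive.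
halveEven : ℕ → ℕ
halveEven x = parity x * x + (1 ∸ parity x) * half x

halveEven-even : ∀ n → halveEven (n * 2) ≡ n
halveEven-even n rewrite parity-even n | half-even n = +-identityʳ n

halveEven-odd : ∀ n → halveEven (suc (n * 2)) ≡ suc (n * 2)
halveEven-odd n rewrite parity-odd n = trans (+-identityʳ _) (+-identityʳ _)

halveEven-fixedOrDecreasing : ∀ x → halveEven x ≡ x ⊎ halveEven x < x
halveEven-fixedOrDecreasing x with even-or-odd x
... | zero  , inj₁ refl = inj₁ refl
... | suc n , inj₁ refl = inj₂ (subst (_< suc n * 2) (sym (halveEven-even (suc n)))
                                      (s≤s (s≤s (m≤m*n n 2))))
... | n     , inj₂ refl = inj₁ (halveEven-odd n)

oddPart : ℕ → ℕ
oddPart x = fold x halveEven x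

oddPart-odd : ∀ n → oddPart (suc (n * 2)) ≡ suc (n * 2)
oddPart-odd n = fold-fixedPoint halveEven (halveEven-odd n) (suc (n * 2))

oddPart-double : ∀ n → oddPart (suc n * 2) ≡ oddPart (suc n)
oddPart-double n = begin
  fold (suc n * 2) halveEven (suc n * 2)                ≡⟨ fold-suc halveEven (suc n * 2) (suc (n * 2)) ⟩
  fold (halveEven (suc n * 2)) halveEven (suc (n * 2))  ≡⟨ cong (λ y → fold y halveEven (suc (n * 2)))
                                                                (halveEven-even (suc n)) ⟩
  fold (suc n) halveEven (suc (n * 2))                  ≡⟨ fold-saturates halveEven halveEven-fixedOrDecreasing
                                                                (s≤s (m≤m*n n 2)) ⟩
  fold (suc n) halveEven (suc n)                        ∎
  where open ≡-Reasoning

-- The sequence D q with ⟨q , D q⟩ = D q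

-- m + 1 = 2ʲ · (2 · source m + 1); D q copies position source m of q to position m.
source : ℕ → ℕ
source m = half (oddPart (suc m))

source-even : ∀ n → source (n * 2) ≡ n
source-even n = trans (cong half (oddPart-odd n)) (half-odd n)

source-odd : ∀ n → source (suc (n * 2)) ≡ source n
source-odd n = cong half (oddPart-double n)

source-≤ : ∀ m → source m ≤ m
source-≤ m rewrite half≡⌊/2⌋ (oddPart (suc m)) =
  ≤-trans (⌊n/2⌋-mono (fold-≤ halveEven halveEven-fixedOrDecreasing (suc m) (suc m)))
          (≤-pred (⌊n/2⌋<n m))

D : Baire → Baire
D q m = q (source m)

π₁-D : ∀ q → π₁ (D q) ≗ q
π₁-D q n = cong q (source-even n)

π₂-D : ∀ q → π₂ (D q) ≗ D q
π₂-D q n = cong q (source-odd n)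

χ≤ : ℕ → ℕ → ℕ
χ≤ x y = 1 ∸ (x ∸ y)

χ≡ : ℕ → ℕ → ℕ
χ≡ x y = 1 ∸ ((x ∸ y) + (y ∸ x))

χ≤-yes : ∀ {x y} → x ≤ y → χ≤ x y ≡ 1
χ≤-yes x≤y = cong (1 ∸_) (m≤n⇒m∸n≡0 x≤y)

χ≤-no : ∀ {x y} → y < x → χ≤ x y ≡ 0
χ≤-no y<x = m≤n⇒m∸n≡0 (m<n⇒0<n∸m y<x)

≡⇒χ≡≡1 : ∀ {x y} → x ≡ y → χ≡ x y ≡ 1
≡⇒χ≡≡1 {zero}  refl = refl
≡⇒χ≡≡1 {suc x} refl = ≡⇒χ≡≡1 {x} refl

χ≡≡1⇒≡ : ∀ x y → χ≡ x y ≡ 1 → x ≡ y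
χ≡≡1⇒≡ zero    zero    _ = refl
χ≡≡1⇒≡ zero    (suc y) e = contradiction (trans (sym e) (0∸n≡0 y)) λ ()
χ≡≡1⇒≡ (suc x) zero    e = contradiction (trans (sym e) (0∸n≡0 (x + 0))) λ ()
χ≡≡1⇒≡ (suc x) (suc y) e = cong suc (χ≡≡1⇒≡ x y e)

χ≡≤1 : ∀ x y → χ≡ x y ≤ 1
χ≡≤1 x y = m∸n≤m 1 ((x ∸ y) + (y ∸ x))

∏< : ℕ → (ℕ → ℕ) → ℕ
∏< zero    f = 1
∏< (suc l) f = ∏< l f * f l

∏<≡1⇒ : ∀ l f → ∏< l f ≡ 1 → ∀ i → i < l → f i ≡ 1
∏<≡1⇒ (suc l) f ∏≡1 i i<1+l with m≤n⇒m<n∨m≡n (≤-pred i<1+l)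
... | inj₁ i<l  = ∏<≡1⇒ l f (m*n≡1⇒m≡1 (∏< l f) (f l) ∏≡1) i i<l
... | inj₂ refl = m*n≡1⇒n≡1 (∏< l f) (f l) ∏≡1

∏<≡1⇐ : ∀ l f → (∀ i → i < l → f i ≡ 1) → ∏< l f ≡ 1
∏<≡1⇐ zero    f _   = refl
∏<≡1⇐ (suc l) f all = cong₂ _*_ (∏<≡1⇐ l f (λ i i<l → all i (m≤n⇒m≤1+n i<l))) (all l ≤-refl)

∏<≤1 : ∀ l f → (∀ i → f i ≤ 1) → ∏< l f ≤ 1
∏<≤1 zero    f _  = ≤-refl
∏<≤1 (suc l) f f≤1 = *-mono-≤ (∏<≤1 l f f≤1) (f≤1 l)

-- Cantor unpairing in closed form

triangle : ℕ → ℕ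
triangle zero    = zero
triangle (suc s) = suc s + triangle s

-- The diagonal s of the enumeration that contains n, i.e. triangle s ≤ n < triangle (suc s).
diagonal : ℕ → ℕ
diagonal zero    = zero
diagonal (suc n) = diagonal n + χ≤ (triangle (suc (diagonal n))) (suc n)

unpair₂ : ℕ → ℕ
unpair₂ n = n ∸ triangle (diagonal n)

unpair₁ : ℕ → ℕ
unpair₁ n = diagonal n ∸ unpair₂ n

nextDiagonal-reached : ∀ s → χ≤ (triangle (suc s)) (suc (triangle s + s)) ≡ 1
nextDiagonal-reached s = χ≤-yes (≤-reflexive (cong suc (+-comm s (triangle s))))

nextDiagonal-notReached : ∀ {s b} → b < s → χ≤ (triangle (suc s)) (suc (triangle s + b)) ≡ 0
nextDiagonal-notReached {s} {b} b<s = χ≤-no (s≤s (begin-strict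
  triangle s + b  <⟨ +-monoʳ-< (triangle s) b<s ⟩
  triangle s + s  ≡⟨ +-comm (triangle s) s ⟩
  s + triangle s  ∎))
  where open ≤-Reasoning

OnDiagonal : ℕ → ℕ × ℕ → Set
OnDiagonal n (a , b) = diagonal n ≡ a + b × n ≡ triangle (a + b) + b

onDiagonal-next : ∀ {n} ab → OnDiagonal n ab → OnDiagonal (suc n) (next ab)
onDiagonal-next {n} (zero , b) (diag≡b , n≡T+b)
  rewrite diag≡b | n≡T+b | nextDiagonal-reached b | +-identityʳ b =
  +-comm b 1 , trans (cong suc (+-comm (triangle b) b)) (sym (+-identityʳ _))
onDiagonal-next {n} (suc a , b) (diag≡s , n≡T+b)
  rewrite diag≡s | n≡T+b | nextDiagonal-notReached {suc a + b} {b} (s≤s (m≤n+m b a)) =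
  trans (+-identityʳ _) (sym (+-suc a b)) ,
  trans (sym (+-suc (triangle (suc a + b)) b)) (cong (λ s → triangle s + suc b) (sym (+-suc a b)))

unpair-onDiagonal : ∀ n → OnDiagonal n (unpair n)
unpair-onDiagonal zero    = refl , refl
unpair-onDiagonal (suc n) = onDiagonal-next (unpair n) (unpair-onDiagonal n)

unpair≡ : ∀ n → unpair n ≡ (unpair₁ n , unpair₂ n)
unpair≡ n with unpair n | unpair-onDiagonal n
... | a , b | diag≡a+b , n≡T+b = cong₂ _,_ (sym a≡) (sym b≡)
  where
  b≡ : unpair₂ n ≡ b
  b≡ = trans (cong₂ (λ x s → x ∸ triangle s) n≡T+b diag≡a+b) (m+n∸m≡n (triangle (a + b)) b)
  a≡ : unpair₁ n ≡ a
  a≡ = trans (cong₂ _∸_ diag≡a+b b≡) (m+n∸n≡m a b)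

unpair-triangle : ∀ s b a → a + b ≡ s → unpair (triangle s + b) ≡ (a , b)
unpair-triangle zero    zero    zero    _    = refl
unpair-triangle (suc s) zero    a       a+0≡s = begin
  unpair (triangle (suc s) + 0)  ≡⟨ cong unpair (trans (+-identityʳ _) (cong suc (+-comm s (triangle s)))) ⟩
  next (unpair (triangle s + s)) ≡⟨ cong next (unpair-triangle s s 0 refl) ⟩
  (suc s , 0)                    ≡⟨ cong (_, 0) (trans (sym a+0≡s) (+-identityʳ a)) ⟩
  (a , 0)                        ∎
  where open ≡-Reasoning
unpair-triangle s (suc b) a a+b+1≡s rewrite +-suc (triangle s) b =
  cong next (unpair-triangle s b (suc a) (trans (sym (+-suc a b)) a+b+1≡s))

unpair-surjective : ∀ a b → ∃ λ n → unpair n ≡ (a , b)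
unpair-surjective a b = triangle (a + b) + b , unpair-triangle (a + b) b a refl

letter : ℕ → ℕ → ℕ
letter i c = unpair₁ (fold c unpair₂ i)

decodeLen-length : ∀ l c → length (decodeLen l c) ≡ l
decodeLen-length zero    c = refl
decodeLen-length (suc l) c = cong suc (decodeLen-length l _)

decodeLen-!! : ∀ l c i → i < l → decodeLen l c !! i ≡ just (letter i c)
decodeLen-!! (suc l) c zero    _         = cong (just ∘ proj₁) (unpair≡ c)
decodeLen-!! (suc l) c (suc i) (s≤s i<l) = begin
  decodeLen l (proj₂ (unpair c)) !! i          ≡⟨ decodeLen-!! l _ i i<l ⟩
  just (letter i (proj₂ (unpair c)))           ≡⟨ cong (just ∘ letter i ∘ proj₂) (unpair≡ c) ⟩
  just (unpair₁ (fold (unpair₂ c) unpair₂ i))  ≡⟨ cong (just ∘ unpair₁) (sym (fold-suc unpair₂ c i)) ⟩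
  just (letter (suc i) c)                      ∎
  where open ≡-Reasoning

decodeLen-surjective : ∀ w → ∃ λ c → decodeLen (length w) c ≡ w
decodeLen-surjective []      = 0 , refl
decodeLen-surjective (x ∷ w) with decodeLen-surjective w
... | c , decode≡w with unpair-surjective x c
... | n , unpair≡xc =
  n , cong₂ _∷_ (cong proj₁ unpair≡xc) (trans (cong (decodeLen (length w) ∘ proj₂) unpair≡xc) decode≡w)

decodeEntry-surjective : ∀ w u → ∃ λ k → decodeEntry k ≡ (w , u)
decodeEntry-surjective w u with decodeLen-surjective w | decodeLen-surjective u
... | cw , decode≡w | cu , decode≡u
  with unpair-surjective (length w) cw | unpair-surjective (length u) cu
... | a , unpair≡a | b , unpair≡b with unpair-surjective a b
... | k , unpair≡k = k , (begin
  decodeEntry k                                      ≡⟨ cong (map decodeWord decodeWord) unpair≡k ⟩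
  (decodeWord a , decodeWord b)                      ≡⟨ cong₂ _,_ (cong (uncurry decodeLen) unpair≡a)
                                                                  (cong (uncurry decodeLen) unpair≡b) ⟩
  (decodeLen (length w) cw , decodeLen (length u) cu) ≡⟨ cong₂ _,_ decode≡w decode≡u ⟩
  (w , u)                                            ∎)
  where open ≡-Reasoning

length₁ code₁ length₂ code₂ : ℕ → ℕ
length₁ k = unpair₁ (unpair₁ k)
code₁   k = unpair₂ (unpair₁ k)
length₂ k = unpair₁ (unpair₂ k)
code₂   k = unpair₂ (unpair₂ k)

decodeEntry≡ : ∀ k → decodeEntry k ≡ (decodeLen (length₁ k) (code₁ k) , decodeLen (length₂ k) (code₂ k))
decodeEntry≡ k rewrite unpair≡ k | unpair≡ (unpair₁ k) | unpair≡ (unpair₂ k) = refl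

prefix : ℕ → Baire → List ℕ
prefix zero    p = []
prefix (suc l) p = p zero ∷ prefix l (p ∘ suc)

prefix-length : ∀ l p → length (prefix l p) ≡ l
prefix-length zero    p = refl
prefix-length (suc l) p = cong suc (prefix-length l (p ∘ suc))

prefix-!! : ∀ l p i → i < l → prefix l p !! i ≡ just (p i)
prefix-!! (suc l) p zero    _         = refl
prefix-!! (suc l) p (suc i) (s≤s i<l) = prefix-!! l (p ∘ suc) i i<l

prefix-⊑ᵇ : ∀ l p → prefix l p ⊑ᵇ p
prefix-⊑ᵇ zero    p = tt
prefix-⊑ᵇ (suc l) p = refl , prefix-⊑ᵇ l (p ∘ suc)

⊑-length : ∀ {w w′} → w ⊑ w′ → length w ≤ length w′
⊑-length []⊑      = z≤n
⊑-length (∷⊑ w⊑w′) = s≤s (⊑-length w⊑w′)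

⊑-!! : ∀ {w w′} → w ⊑ w′ → ∀ i → i < length w → w !! i ≡ w′ !! i
⊑-!! (∷⊑ w⊑w′) zero    _         = refl
⊑-!! (∷⊑ w⊑w′) (suc i) (s≤s i<l) = ⊑-!! w⊑w′ i i<l

⊑-by-!! : ∀ u u′ → length u ≤ length u′ → (∀ i → i < length u → u !! i ≡ u′ !! i) → u ⊑ u′
⊑-by-!! []      u′       _         _     = []⊑
⊑-by-!! (x ∷ u) (y ∷ u′) (s≤s len≤) agree with just-injective (agree zero (s≤s z≤n))
... | refl = ∷⊑ (⊑-by-!! u u′ len≤ (λ i i<l → agree (suc i) (s≤s i<l)))

⊑ᵇ-cong : ∀ {p p′} → p ≗ p′ → ∀ w → w ⊑ᵇ p → w ⊑ᵇ p′
⊑ᵇ-cong p≗p′ []      _              = tt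
⊑ᵇ-cong p≗p′ (x ∷ w) (x≡p0 , w⊑ᵇp) = trans x≡p0 (p≗p′ zero) , ⊑ᵇ-cong (p≗p′ ∘ suc) w w⊑ᵇp

Entry-cong : ∀ {q q′} → q ≗ q′ → ∀ {w u} → Entry q w u → Entry q′ w u
Entry-cong q≗q′ (k , c , qk≡1+c , decode≡wu) = k , c , trans (sym (q≗q′ k)) qk≡1+c , decode≡wu

Consistent-cong : ∀ {q q′} → q ≗ q′ → Consistent q → Consistent q′
Consistent-cong q≗q′ consistent e e′ = consistent (Entry-cong (sym ∘ q≗q′) e) (Entry-cong (sym ∘ q≗q′) e′)

Φ≡-cong : ∀ {q q′ p p′ r} → q ≗ q′ → p ≗ p′ → Φ≡ q p r → Φ≡ q′ p′ r
Φ≡-cong q≗q′ p≗p′ Φqp≡r n with Φqp≡r n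
... | consistent , w , u , entry , w⊑ᵇp , u!!n =
  Consistent-cong q≗q′ consistent , w , u , Entry-cong q≗q′ entry , ⊑ᵇ-cong p≗p′ w w⊑ᵇp , u!!n

-- A Φ-name of D

DGraph : List ℕ → List ℕ → Set
DGraph w u = length u ≡ length w × (∀ i → i < length w → u !! i ≡ w !! source i)

DGraph-monotone : ∀ {w u w′ u′} → DGraph w u → DGraph w′ u′ → w ⊑ w′ → u ⊑ u′
DGraph-monotone {w} {u} {w′} {u′} (|u|≡|w| , u≡w∘source) (|u′|≡|w′| , u′≡w′∘source) w⊑w′ =
  ⊑-by-!! u u′ (subst₂ _≤_ (sym |u|≡|w|) (sym |u′|≡|w′|) (⊑-length w⊑w′)) agree
  where
  agree : ∀ i → i < length u → u !! i ≡ u′ !! i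
  agree i i<|u| = begin
    u !! i          ≡⟨ u≡w∘source i i<|w| ⟩
    w !! source i   ≡⟨ ⊑-!! w⊑w′ (source i) (≤-<-trans (source-≤ i) i<|w|) ⟩
    w′ !! source i  ≡⟨ sym (u′≡w′∘source i (<-≤-trans i<|w| (⊑-length w⊑w′))) ⟩
    u′ !! i         ∎
    where
    open ≡-Reasoning
    i<|w| = subst (i <_) |u|≡|w| i<|u|

DGraph-prefix : ∀ l p → DGraph (prefix l p) (prefix l (D p))
DGraph-prefix l p = trans (prefix-length l (D p)) (sym (prefix-length l p)) , agree
  where
  agree : ∀ i → i < length (prefix l p) → prefix l (D p) !! i ≡ prefix l p !! source i
  agree i i<|w| = trans (prefix-!! l (D p) i i<l) (sym (prefix-!! l p (source i) (≤-<-trans (source-≤ i) i<l)))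
    where i<l = subst (i <_) (prefix-length l p) i<|w|

DGraph-decodeLen⇒ : ∀ {l₁ c₁ l₂ c₂} → l₂ ≡ l₁ → (∀ i → i < l₁ → letter i c₂ ≡ letter (source i) c₁) →
                    DGraph (decodeLen l₁ c₁) (decodeLen l₂ c₂)
DGraph-decodeLen⇒ {l₁} {c₁} {l₂} {c₂} refl agree =
  trans (decodeLen-length l₂ c₂) (sym (decodeLen-length l₁ c₁)) , λ i i<|w| →
    let i<l = subst (i <_) (decodeLen-length l₁ c₁) i<|w| in begin
    decodeLen l₂ c₂ !! i            ≡⟨ decodeLen-!! l₂ c₂ i i<l ⟩
    just (letter i c₂)              ≡⟨ cong just (agree i i<l) ⟩
    just (letter (source i) c₁)     ≡⟨ sym (decodeLen-!! l₁ c₁ (source i) (≤-<-trans (source-≤ i) i<l)) ⟩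
    decodeLen l₁ c₁ !! source i     ∎
  where open ≡-Reasoning

DGraph-decodeLen⇐ : ∀ {l₁ c₁ l₂ c₂} → DGraph (decodeLen l₁ c₁) (decodeLen l₂ c₂) →
                    l₂ ≡ l₁ × (∀ i → i < l₁ → letter i c₂ ≡ letter (source i) c₁)
DGraph-decodeLen⇐ {l₁} {c₁} {l₂} {c₂} (|u|≡|w| , agree) = l₂≡l₁ , λ i i<l → just-injective (begin
  just (letter i c₂)              ≡⟨ sym (decodeLen-!! l₂ c₂ i (subst (i <_) (sym l₂≡l₁) i<l)) ⟩
  decodeLen l₂ c₂ !! i            ≡⟨ agree i (subst (i <_) (sym (decodeLen-length l₁ c₁)) i<l) ⟩
  decodeLen l₁ c₁ !! source i     ≡⟨ decodeLen-!! l₁ c₁ (source i) (≤-<-trans (source-≤ i) i<l) ⟩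
  just (letter (source i) c₁)     ∎)
  where
  open ≡-Reasoning
  l₂≡l₁ = trans (sym (decodeLen-length l₂ c₂)) (trans |u|≡|w| (decodeLen-length l₁ c₁))

agree : ℕ → ℕ → ℕ
agree k i = χ≡ (letter i (code₂ k)) (letter (source i) (code₁ k))

isDGraphEntry : ℕ → ℕ
isDGraphEntry k = χ≡ (length₂ k) (length₁ k) * ∏< (length₁ k) (agree k)

isDGraphEntry≤1 : ∀ k → isDGraphEntry k ≤ 1
isDGraphEntry≤1 k = *-mono-≤ (χ≡≤1 (length₂ k) (length₁ k)) (∏<≤1 (length₁ k) (agree k)
  (λ i → χ≡≤1 (letter i (code₂ k)) (letter (source i) (code₁ k))))

isDGraphEntry≡1⇒ : ∀ k → isDGraphEntry k ≡ 1 → uncurry DGraph (decodeEntry k)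
isDGraphEntry≡1⇒ k isDGraph = subst (uncurry DGraph) (sym (decodeEntry≡ k)) (DGraph-decodeLen⇒
  (χ≡≡1⇒≡ _ _ (m*n≡1⇒m≡1 _ _ isDGraph))
  (λ i i<l → χ≡≡1⇒≡ _ _ (∏<≡1⇒ (length₁ k) (agree k) (m*n≡1⇒n≡1 lengthsAgree _ isDGraph) i i<l)))
  where lengthsAgree = χ≡ (length₂ k) (length₁ k)

isDGraphEntry≡1⇐ : ∀ k → uncurry DGraph (decodeEntry k) → isDGraphEntry k ≡ 1
isDGraphEntry≡1⇐ k dGraph with DGraph-decodeLen⇐ (subst (uncurry DGraph) (decodeEntry≡ k) dGraph)
... | l₂≡l₁ , letters≡ =
  cong₂ _*_ (≡⇒χ≡≡1 l₂≡l₁) (∏<≡1⇐ (length₁ k) (agree k) (λ i i<l → ≡⇒χ≡≡1 (letters≡ i i<l)))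

-- Lists entry k (takes the value suc k) exactly when decodeEntry k is a pair of DGraph.
nameD : Baire
nameD k = isDGraphEntry k * suc k

indicator*suc≡suc⇒ : ∀ {m k c} → m ≤ 1 → m * suc k ≡ suc c → m ≡ 1 × c ≡ k
indicator*suc≡suc⇒ {zero}        _        ()
indicator*suc≡suc⇒ {suc zero} {k} _       1+k+0≡1+c =
  refl , suc-injective (trans (sym 1+k+0≡1+c) (+-identityʳ (suc k)))
indicator*suc≡suc⇒ {suc (suc _)} (s≤s ()) _

nameD-entry⇒DGraph : ∀ {w u} → Entry nameD w u → DGraph w u
nameD-entry⇒DGraph (k , c , nameDk≡1+c , decode≡wu) with indicator*suc≡suc⇒ (isDGraphEntry≤1 k) nameDk≡1+c
... | isDGraph , refl = subst (uncurry DGraph) decode≡wu (isDGraphEntry≡1⇒ k isDGraph)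

DGraph⇒nameD-entry : ∀ {w u} → DGraph w u → Entry nameD w u
DGraph⇒nameD-entry {w} {u} dGraph with decodeEntry-surjective w u
... | k , decode≡wu = k , k , nameDk≡1+k , decode≡wu
  where
  nameDk≡1+k : nameD k ≡ suc k
  nameDk≡1+k = trans (cong (_* suc k) (isDGraphEntry≡1⇐ k (subst (uncurry DGraph) (sym decode≡wu) dGraph)))
                     (+-identityʳ (suc k))

nameD-consistent : Consistent nameD
nameD-consistent entry entry′ = DGraph-monotone (nameD-entry⇒DGraph entry) (nameD-entry⇒DGraph entry′)

nameD-names-D : ∀ p → Φ≡ nameD p (D p)
nameD-names-D p n = nameD-consistent , prefix (suc n) p , prefix (suc n) (D p) ,
  DGraph⇒nameD-entry (DGraph-prefix (suc n) p) , prefix-⊑ᵇ (suc n) p , prefix-!! (suc n) (D p) n ≤-refl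

-- Primitive recursive programs

_computes₁_ : Rec 1 → (ℕ → ℕ) → Set
P computes₁ f = ∀ x → P [ x ∷ [] ]⇓ f x

_computes₂_ : Rec 2 → (ℕ → ℕ → ℕ) → Set
P computes₂ f = ∀ x y → P [ x ∷ y ∷ [] ]⇓ f x y

arg₀ : ∀ {n} → Rec (suc n)
arg₀ = proj fzero

arg₁ : ∀ {n} → Rec (suc (suc n))
arg₁ = proj (fsuc fzero)

arg₂ : ∀ {n} → Rec (suc (suc (suc n)))
arg₂ = proj (fsuc (fsuc fzero))

comp₁ : ∀ {n} → Rec 1 → Rec n → Rec n
comp₁ f g = comp f (g ∷ [])

comp₂ : ∀ {n} → Rec 2 → Rec n → Rec n → Rec n
comp₂ f g h = comp f (g ∷ h ∷ [])

comp₁⇓ : ∀ {n f g} {xs : Vec ℕ n} {y v} → g [ xs ]⇓ y → f [ y ∷ [] ]⇓ v → comp₁ f g [ xs ]⇓ v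
comp₁⇓ g⇓ f⇓ = comp⇓ (∷⇓ g⇓ []⇓) f⇓

comp₂⇓ : ∀ {n f g h} {xs : Vec ℕ n} {a b v} →
         g [ xs ]⇓ a → h [ xs ]⇓ b → f [ a ∷ b ∷ [] ]⇓ v → comp₂ f g h [ xs ]⇓ v
comp₂⇓ g⇓ h⇓ f⇓ = comp⇓ (∷⇓ g⇓ (∷⇓ h⇓ []⇓)) f⇓

prec₁⇓ : ∀ {f g} (H : ℕ → ℕ) → f [ [] ]⇓ H 0 → (∀ y → g [ y ∷ H y ∷ [] ]⇓ H (suc y)) →
         prec f g computes₁ H
prec₁⇓ H f⇓ g⇓ zero    = prec0⇓ f⇓
prec₁⇓ H f⇓ g⇓ (suc y) = precS⇓ (prec₁⇓ H f⇓ g⇓ y) (g⇓ y)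

prec₂⇓ : ∀ {f g} (H : ℕ → ℕ → ℕ) → f computes₁ H 0 → (∀ y x → g [ y ∷ H y x ∷ x ∷ [] ]⇓ H (suc y) x) →
         prec f g computes₂ H
prec₂⇓ H f⇓ g⇓ zero    x = prec0⇓ (f⇓ x)
prec₂⇓ H f⇓ g⇓ (suc y) x = precS⇓ (prec₂⇓ H f⇓ g⇓ y x) (g⇓ y x)

oneᴿ : ∀ {n} → Rec n
oneᴿ = comp₁ succ zer

oneᴿ⇓ : ∀ {n} {xs : Vec ℕ n} → oneᴿ [ xs ]⇓ 1
oneᴿ⇓ = comp₁⇓ zer⇓ succ⇓

addᴿ : Rec 2
addᴿ = prec arg₀ (comp₁ succ arg₁)

addᴿ⇓ : addᴿ computes₂ _+_
addᴿ⇓ = prec₂⇓ _+_ (λ _ → proj⇓) (λ _ _ → comp₁⇓ proj⇓ succ⇓)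

mulᴿ : Rec 2
mulᴿ = prec zer (comp₂ addᴿ arg₂ arg₁)

mulᴿ⇓ : mulᴿ computes₂ _*_
mulᴿ⇓ = prec₂⇓ _*_ (λ _ → zer⇓) (λ y x → comp₂⇓ proj⇓ proj⇓ (addᴿ⇓ x (y * x)))

predᴿ : Rec 1
predᴿ = prec zer arg₀

predᴿ⇓ : predᴿ computes₁ pred
predᴿ⇓ = prec₁⇓ pred zer⇓ (λ _ → proj⇓)

countdownᴿ : Rec 2
countdownᴿ = prec arg₀ (comp₁ predᴿ arg₁)

countdownᴿ⇓ : countdownᴿ computes₂ (λ y x → x ∸ y)
countdownᴿ⇓ = prec₂⇓ (λ y x → x ∸ y) (λ _ → proj⇓) λ y x →
  subst (countdownStep y x) (pred[m∸n]≡m∸[1+n] x y) (comp₁⇓ proj⇓ (predᴿ⇓ (x ∸ y)))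
  where
  countdownStep : ℕ → ℕ → ℕ → Set
  countdownStep y x v = comp₁ predᴿ arg₁ [ y ∷ x ∸ y ∷ x ∷ [] ]⇓ v

monusᴿ : Rec 2
monusᴿ = comp₂ countdownᴿ arg₁ arg₀

monusᴿ⇓ : monusᴿ computes₂ _∸_
monusᴿ⇓ x y = comp₂⇓ proj⇓ proj⇓ (countdownᴿ⇓ y x)

χ≤ᴿ : Rec 2
χ≤ᴿ = comp₂ monusᴿ oneᴿ monusᴿ

χ≤ᴿ⇓ : χ≤ᴿ computes₂ χ≤
χ≤ᴿ⇓ x y = comp₂⇓ oneᴿ⇓ (monusᴿ⇓ x y) (monusᴿ⇓ 1 (x ∸ y))

χ≡ᴿ : Rec 2
χ≡ᴿ = comp₂ monusᴿ oneᴿ (comp₂ addᴿ monusᴿ (comp₂ monusᴿ arg₁ arg₀))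

χ≡ᴿ⇓ : χ≡ᴿ computes₂ χ≡
χ≡ᴿ⇓ x y = comp₂⇓ oneᴿ⇓ (comp₂⇓ (monusᴿ⇓ x y) (comp₂⇓ proj⇓ proj⇓ (monusᴿ⇓ y x)) (addᴿ⇓ _ _)) (monusᴿ⇓ _ _)

foldᴿ : Rec 1 → Rec 2
foldᴿ g = prec arg₀ (comp₁ g arg₁)

foldᴿ⇓ : ∀ {g f} → g computes₁ f → foldᴿ g computes₂ (λ i x → fold x f i)
foldᴿ⇓ {f = f} g⇓ = prec₂⇓ (λ i x → fold x f i) (λ _ → proj⇓) (λ _ _ → comp₁⇓ proj⇓ (g⇓ _))

∏ᴿ : Rec 2 → Rec 2
∏ᴿ F = prec oneᴿ (comp₂ mulᴿ arg₁ (comp₂ F arg₀ arg₂))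

∏ᴿ⇓ : ∀ {F} {f : ℕ → ℕ → ℕ} → F computes₂ (λ i k → f k i) → ∏ᴿ F computes₂ (λ l k → ∏< l (f k))
∏ᴿ⇓ {f = f} F⇓ = prec₂⇓ (λ l k → ∏< l (f k)) (λ _ → oneᴿ⇓)
  (λ l k → comp₂⇓ proj⇓ (comp₂⇓ proj⇓ proj⇓ (F⇓ l k)) (mulᴿ⇓ _ _))

triangleᴿ : Rec 1
triangleᴿ = prec zer (comp₂ addᴿ (comp₁ succ arg₀) arg₁)

triangleᴿ⇓ : triangleᴿ computes₁ triangle
triangleᴿ⇓ = prec₁⇓ triangle zer⇓ (λ s → comp₂⇓ (comp₁⇓ proj⇓ succ⇓) proj⇓ (addᴿ⇓ (suc s) (triangle s)))

diagonalᴿ : Rec 1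
diagonalᴿ = prec zer (comp₂ addᴿ arg₁ (comp₂ χ≤ᴿ (comp₁ triangleᴿ (comp₁ succ arg₁)) (comp₁ succ arg₀)))

diagonalᴿ⇓ : diagonalᴿ computes₁ diagonal
diagonalᴿ⇓ = prec₁⇓ diagonal zer⇓ λ n → comp₂⇓ proj⇓
  (comp₂⇓ (comp₁⇓ (comp₁⇓ proj⇓ succ⇓) (triangleᴿ⇓ _)) (comp₁⇓ proj⇓ succ⇓) (χ≤ᴿ⇓ _ _)) (addᴿ⇓ _ _)

unpair₂ᴿ : Rec 1
unpair₂ᴿ = comp₂ monusᴿ arg₀ (comp₁ triangleᴿ diagonalᴿ)

unpair₂ᴿ⇓ : unpair₂ᴿ computes₁ unpair₂
unpair₂ᴿ⇓ n = comp₂⇓ proj⇓ (comp₁⇓ (diagonalᴿ⇓ n) (triangleᴿ⇓ _)) (monusᴿ⇓ _ _)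

unpair₁ᴿ : Rec 1
unpair₁ᴿ = comp₂ monusᴿ diagonalᴿ unpair₂ᴿ

unpair₁ᴿ⇓ : unpair₁ᴿ computes₁ unpair₁
unpair₁ᴿ⇓ n = comp₂⇓ (diagonalᴿ⇓ n) (unpair₂ᴿ⇓ n) (monusᴿ⇓ _ _)

letterᴿ : Rec 2
letterᴿ = comp₁ unpair₁ᴿ (foldᴿ unpair₂ᴿ)

letterᴿ⇓ : letterᴿ computes₂ letter
letterᴿ⇓ i c = comp₁⇓ (foldᴿ⇓ unpair₂ᴿ⇓ i c) (unpair₁ᴿ⇓ _)

parityᴿ : Rec 1
parityᴿ = prec zer (comp₂ monusᴿ oneᴿ arg₁)

parityᴿ⇓ : parityᴿ computes₁ parity
parityᴿ⇓ = prec₁⇓ parity zer⇓ (λ _ → comp₂⇓ oneᴿ⇓ proj⇓ (monusᴿ⇓ _ _))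

halfᴿ : Rec 1
halfᴿ = prec zer (comp₂ addᴿ arg₁ (comp₁ parityᴿ arg₀))

halfᴿ⇓ : halfᴿ computes₁ half
halfᴿ⇓ = prec₁⇓ half zer⇓ (λ _ → comp₂⇓ proj⇓ (comp₁⇓ proj⇓ (parityᴿ⇓ _)) (addᴿ⇓ _ _))

halveEvenᴿ : Rec 1
halveEvenᴿ = comp₂ addᴿ (comp₂ mulᴿ parityᴿ arg₀) (comp₂ mulᴿ (comp₂ monusᴿ oneᴿ parityᴿ) halfᴿ)

halveEvenᴿ⇓ : halveEvenᴿ computes₁ halveEven
halveEvenᴿ⇓ x = comp₂⇓ (comp₂⇓ (parityᴿ⇓ x) proj⇓ (mulᴿ⇓ _ _))
  (comp₂⇓ (comp₂⇓ oneᴿ⇓ (parityᴿ⇓ x) (monusᴿ⇓ _ _)) (halfᴿ⇓ x) (mulᴿ⇓ _ _)) (addᴿ⇓ _ _)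

sourceᴿ : Rec 1
sourceᴿ = comp₁ halfᴿ (comp₂ (foldᴿ halveEvenᴿ) (comp₁ succ arg₀) (comp₁ succ arg₀))

sourceᴿ⇓ : sourceᴿ computes₁ source
sourceᴿ⇓ m = comp₁⇓ (comp₂⇓ (comp₁⇓ proj⇓ succ⇓) (comp₁⇓ proj⇓ succ⇓) (foldᴿ⇓ halveEvenᴿ⇓ _ _)) (halfᴿ⇓ _)

length₁ᴿ code₁ᴿ length₂ᴿ code₂ᴿ : Rec 1
length₁ᴿ = comp₁ unpair₁ᴿ unpair₁ᴿ
code₁ᴿ   = comp₁ unpair₂ᴿ unpair₁ᴿ
length₂ᴿ = comp₁ unpair₁ᴿ unpair₂ᴿ
code₂ᴿ   = comp₁ unpair₂ᴿ unpair₂ᴿ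

length₁ᴿ⇓ : length₁ᴿ computes₁ length₁
length₁ᴿ⇓ k = comp₁⇓ (unpair₁ᴿ⇓ k) (unpair₁ᴿ⇓ _)

code₁ᴿ⇓ : code₁ᴿ computes₁ code₁
code₁ᴿ⇓ k = comp₁⇓ (unpair₁ᴿ⇓ k) (unpair₂ᴿ⇓ _)

length₂ᴿ⇓ : length₂ᴿ computes₁ length₂
length₂ᴿ⇓ k = comp₁⇓ (unpair₂ᴿ⇓ k) (unpair₁ᴿ⇓ _)

code₂ᴿ⇓ : code₂ᴿ computes₁ code₂
code₂ᴿ⇓ k = comp₁⇓ (unpair₂ᴿ⇓ k) (unpair₂ᴿ⇓ _)

agreeᴿ : Rec 2
agreeᴿ = comp₂ χ≡ᴿ (comp₂ letterᴿ arg₀ (comp₁ code₂ᴿ arg₁)) (comp₂ letterᴿ (comp₁ sourceᴿ arg₀) (comp₁ code₁ᴿ arg₁))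

agreeᴿ⇓ : agreeᴿ computes₂ (λ i k → agree k i)
agreeᴿ⇓ i k = comp₂⇓ (comp₂⇓ proj⇓ (comp₁⇓ proj⇓ (code₂ᴿ⇓ k)) (letterᴿ⇓ _ _))
                     (comp₂⇓ (comp₁⇓ proj⇓ (sourceᴿ⇓ i)) (comp₁⇓ proj⇓ (code₁ᴿ⇓ k)) (letterᴿ⇓ _ _))
                     (χ≡ᴿ⇓ _ _)

nameDᴿ : Rec 1
nameDᴿ = comp₂ mulᴿ (comp₂ mulᴿ (comp₂ χ≡ᴿ length₂ᴿ length₁ᴿ) (comp₂ (∏ᴿ agreeᴿ) length₁ᴿ arg₀)) (comp₁ succ arg₀)

nameDᴿ⇓ : nameDᴿ computes₁ nameD
nameDᴿ⇓ k = comp₂⇓ (comp₂⇓ (comp₂⇓ (length₂ᴿ⇓ k) (length₁ᴿ⇓ k) (χ≡ᴿ⇓ _ _))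
                           (comp₂⇓ (length₁ᴿ⇓ k) proj⇓ (∏ᴿ⇓ agreeᴿ⇓ _ _)) (mulᴿ⇓ _ _))
                   (comp₁⇓ proj⇓ succ⇓) (mulᴿ⇓ _ _)

D-computable : ComputableTotal D
D-computable = nameD , (nameDᴿ , nameDᴿ⇓) , nameD-names-D

Φ≡⇒U≡ : ∀ q r → Φ≡ q (D q) r → U≡ (D q) r
Φ≡⇒U≡ q r = Φ≡-cong (sym ∘ π₁-D q) (sym ∘ π₂-D q)

proposition16 : ComputablyDiscontinuousTotal DIS
proposition16 = D , D-computable , λ q r Φq[Dq]≡r r∈DIS → r∈DIS (Φ≡⇒U≡ q r Φq[Dq]≡r)
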